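{- Let $\varphi\colon\mathcal{A}\to\mathcal{A}^*$ be an idempotent substitution and let $Y$ be a subsystem of $X_\varphi$. Then $Y$ is minimal if and only if $Y=X_b$ for some minimal letter $b\in\mathcal{A}$.
   Context: $\mathcal{A}$ is a finite alphabet, $\mathcal{A}^\omega$ the one-sided sequences with product topology and shift $T$; a subsystem is a closed $T$-invariant subset; it is minimal if nonempty and its only subsystems are itself and $\emptyset$. A substitution $\varphi\colon\mathcal{A}\to\mathcal{A}^*$ is extended to words by concatenation and is assumed growing ($|\varphi^n(a)|\to\infty$ for every $a$). $X_\varphi=\{z\in\mathcal{A}^\omega:$ every factor of $z$ is a factor of $\varphi^n(a)$ for some $n\ge0$, $a\in\mathcal{A}\}$ and $X_b=\{z\in X_\varphi:$ every factor of $z$ is a factor of $\varphi^n(b)$ for some $n\ge 0\}$. Write $b\succcurlyeq a$ if $a$ occurs in $\varphi^n(b)$ for some $n\ge0$, $a\sim b$ if $a\succcurlyeq b\succcurlyeq a$, and $b\succ a$ if $b\succcurlyeq a$ and not $a\sim b$; a letter $b$ is minimal if there is no letter $a$ with $b\succ a$. A letter $a$ is ample if it occurs in $\varphi^n(a)$ for some $n\ge1$; $\mathcal{A}'$ denotes the set of ample letters, and for $a\in\mathcal{A}'$, $\lambda_\varphi(a)$ is the letter equivalent to $a$ that occurs in $\varphi(a)$ at the last position among all letters equivalent to $a$. A letter $a$ is prolongable if it is the first letter of $\varphi(a)$. The substitution $\varphi$ is idempotent if: (1) for all $a$ and $n\ge1$ the set of letters occurring in $\varphi(a)$ equals the set of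 letters occurring in $\varphi^n(a)$; (2) for all $a$ and $n\ge1$ the set of letters occurring at least twice in $\varphi(a)$ equals that for $\varphi^n(a)$; (3) for every $a$, the first letter of $\varphi(a)$ is prolongable; (4) $\lambda_\varphi\colon\mathcal{A}'\to\mathcal{A}'$ satisfies $\lambda_\varphi\circ\lambda_\varphi=\lambda_\varphi$. -}

module Defs where

open import Data.Nat using (ℕ; zero; suc; _+_; _≤_; _<_)
open import Data.Fin as Fin using (Fin)
open import Data.Fin.Properties using () renaming (_≟_ to _≟ᶠ_)
open import Data.List using (List; []; _∷_; _++_; length; lookup; concatMap; map; upTo; head)
open import Data.List.Membership.Propositional using (_∈_)
open import Data.Maybe using (just)
open import Data.Product using (Σ; ∃; ∃-syntax; _×_; _,_)
open import Relation.Nullary using (¬_)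
open import Relation.Binary.PropositionalEquality using (_≡_)
open import Function.Bundles using (_⇔_)

open import Relation.Nullary using (yes; no)

occ : {k : ℕ} → Fin k → List (Fin k) → ℕ
occ c [] = zero
occ c (x ∷ w) with c ≟ᶠ x
... | yes _ = suc (occ c w)
... | no _  = occ c w

Seq : ℕ → Set
Seq k = ℕ → Fin k

Substitution : ℕ → Set
Substitution k = Fin k → List (Fin k)

module _ {k : ℕ} (φ : Substitution k) where

  φ* : List (Fin k) → List (Fin k)
  φ* = concatMap φ

  iterW : ℕ → List (Fin k) → List (Fin k)
  iterW zero    w = w
  iterW (suc n) w = φ* (iterW n w)

  φ^ : ℕ → Fin k → List (Fin k)
  φ^ n a = iterW n (a ∷ [])

  Growing : Set
  Growing = ∀ a m → ∃[ n ] m ≤ length (φ^ n a)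

  _≽_ : Fin k → Fin k → Set
  b ≽ a = ∃[ n ] a ∈ φ^ n b

  _∼_ : Fin k → Fin k → Set
  a ∼ b = a ≽ b × b ≽ a

  _≻_ : Fin k → Fin k → Set
  b ≻ a = b ≽ a × ¬ (a ∼ b)

  MinimalLetter : Fin k → Set
  MinimalLetter b = ¬ (∃[ a ] b ≻ a)

  Ample : Fin k → Set
  Ample a = ∃[ n ] a ∈ φ^ (suc n) a

  Prolongable : Fin k → Set
  Prolongable a = head (φ a) ≡ just a

  -- IsLambda a c : c is λ_φ(a), i.e. c ∼ a, c occurs in φ(a) at position i,
  -- and no letter at a later position of φ(a) is equivalent to a.
  IsLambda : Fin k → Fin k → Set
  IsLambda a c = c ∼ a × Σ (Fin (length (φ a))) λ i →
    lookup (φ a) i ≡ c × (∀ j → i Fin.< j → ¬ (lookup (φ a) j ∼ a))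

  Idempotent : Set
  Idempotent =
    (∀ a n c → (c ∈ φ a) ⇔ (c ∈ φ^ (suc n) a))
    × (∀ a n c → (2 ≤ occ c (φ a)) ⇔ (2 ≤ occ c (φ^ (suc n) a)))
    × (∀ a c → head (φ a) ≡ just c → Prolongable c)
    -- (4) λ_φ ∘ λ_φ = λ_φ on ample letters
    × (∀ a c d → Ample a → IsLambda a c → IsLambda c d → d ≡ c)

_⊑_ : {k : ℕ} → List (Fin k) → List (Fin k) → Set
w ⊑ u = ∃[ p ] ∃[ s ] u ≡ p ++ w ++ s

window : {k : ℕ} → Seq k → ℕ → ℕ → List (Fin k)
window z i m = map (λ j → z (i + j)) (upTo m)

SeqSet : ℕ → Set₁
SeqSet k = Seq k → Set

_⊆ˢ_ : {k : ℕ} → SeqSet k → SeqSet k → Set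
Y ⊆ˢ Z = ∀ z → Y z → Z z

_≐_ : {k : ℕ} → SeqSet k → SeqSet k → Set
Y ≐ Z = Y ⊆ˢ Z × Z ⊆ˢ Y

Empty : {k : ℕ} → SeqSet k → Set
Empty Y = ∀ z → ¬ Y z

T : {k : ℕ} → Seq k → Seq k
T z n = z (suc n)

-- closed in the product topology: every sequence all of whose prefixes
-- are prefixes of elements of Y belongs to Y
Closed : {k : ℕ} → SeqSet k → Set
Closed {k} Y = ∀ (x : Seq k) →
  (∀ m → ∃[ y ] Y y × (∀ j → j < m → y j ≡ x j)) → Y x

ShiftInvariant : {k : ℕ} → SeqSet k → Set
ShiftInvariant Y = ∀ z → Y z → Y (T z)

Subsystem : {k : ℕ} → SeqSet k → Set
Subsystem Y = Closed Y × ShiftInvariant Y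

SubsystemOf : {k : ℕ} → SeqSet k → SeqSet k → Set
SubsystemOf Y X = Subsystem Y × Y ⊆ˢ X

Minimal : {k : ℕ} → SeqSet k → Set₁
Minimal {k} Y = (∃[ y ] Y y) ×
  (∀ (Z : SeqSet k) → SubsystemOf Z Y → (Z ≐ Y) Data.Sum.⊎ Empty Z)
  where import Data.Sum

module _ {k : ℕ} (φ : Substitution k) where

  X_φ : SeqSet k
  X_φ z = ∀ i m → ∃[ n ] ∃[ a ] window z i m ⊑ φ^ φ n a

  X_ : Fin k → SeqSet k
  X_ b z = X_φ z × (∀ i m → ∃[ n ] window z i m ⊑ φ^ φ n b)

-- For an idempotent φ, a minimal letter b occurs in φ(c) for every c with b ≽ c, and every letter a
-- has a minimal letter in φ(a); this only uses that φ(a) and φ^(n+1)(a) contain the same letters.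
-- A factor of some φ^N(a) longer than twice the maximal length of the φ^(n+1)(c) contains a whole block
-- φ^(n+1)(c) with a ≽ c, hence a copy of φ^n(b) for some minimal b. So if b is minimal, every
-- sequence of X_b contains all φ^n(b), and X_b is minimal; conversely each y in X_φ contains, for
-- every n, some φ^n(b) with b minimal, and by pigeonhole on the alphabet one minimal b works for all
-- n, so X_b lies in the orbit closure of y. X_b is nonempty because the prolongable first letter of
-- φ(b) generates a fixed point of φ.

module Submission where

open import Defs
open import Axiom.DoubleNegationElimination using (em⇒dne)
open import Axiom.ExcludedMiddle using (ExcludedMiddle)
open import Data.Empty using (⊥-elim)
open import Data.Fin using (Fin; zero; suc)
open import Data.Fin.Induction using (spo-wellFounded)
open import Data.List using (List; []; _∷_; _++_; length; concatMap; map; applyUpTo; head)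
open import Data.List.Membership.Propositional using (_∈_)
open import Data.List.Membership.Propositional.Properties using (∈-++⁺ˡ; ∈-++⁺ʳ)
open import Data.List.Properties using (++-assoc; ++-identityʳ; length-++; ∷-injective; ++-conicalˡ; ++-conicalʳ; concatMap-++)
open import Data.List.Relation.Unary.Any using (here; there)
open import Data.Maybe using (just)
open import Data.Nat using (ℕ; zero; suc; _+_; _≤_; _<_; _≤′_; ≤′-refl; ≤′-step; z≤n; s≤s; _≤?_)
open import Data.Nat.Properties
  using (≤-refl; ≤-trans; ≤-reflexive; ≤-total; <⇒≤; ≰⇒>; n≮0; m≤m+n; m≤n+m; +-monoˡ-≤; +-monoʳ-<;
         +-mono-≤; +-cancelˡ-<; +-assoc; ≤⇒≤′; m≤n⇒∃[o]m+o≡n; <-irrefl; module ≤-Reasoning)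
open import Data.Product using (∃-syntax; _×_; _,_; proj₁; proj₂; map₁; map₂; uncurry)
open import Data.Sum using (_⊎_; inj₁; inj₂; [_,_]′)
open import Function using (_∘_; id)
open import Function.Bundles using (_⇔_; mk⇔; Equivalence)
open import Induction.WellFounded using (Acc; acc)
open import Level using (0ℓ)
open import Relation.Binary.PropositionalEquality
open import Relation.Binary.Structures using (IsStrictPartialOrder)
open import Relation.Nullary using (¬_; yes; no)

module _ {A : Set} where

  ++-equidivisible : (xs ys zs ws : List A) → xs ++ ys ≡ zs ++ ws → length xs ≤ length zs →
                     ∃[ m ] zs ≡ xs ++ m × ys ≡ m ++ ws
  ++-equidivisible []       ys zs       ws eq _         = zs , refl , eq
  ++-equidivisible (x ∷ xs) ys (z ∷ zs) ws eq (s≤s len) with ∷-injective eq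
  ... | refl , eq′ with ++-equidivisible xs ys zs ws eq′ len
  ...   | m , refl , ys≡ = m , refl , ys≡

  head-just : ∀ {xs : List A} {x} → head xs ≡ just x → ∃[ r ] xs ≡ x ∷ r
  head-just {xs = x ∷ r} refl = r , refl

  nthOr : A → List A → ℕ → A
  nthOr d []       t       = d
  nthOr d (x ∷ xs) zero    = x
  nthOr d (x ∷ xs) (suc t) = nthOr d xs t

  nthOr-++ : ∀ d (xs ys : List A) {t} → t < length xs → nthOr d (xs ++ ys) t ≡ nthOr d xs t
  nthOr-++ d (x ∷ xs) ys {zero}  _         = refl
  nthOr-++ d (x ∷ xs) ys {suc t} (s≤s t<) = nthOr-++ d xs ys t<

module _ {k : ℕ} where

  private
    Word : Set
    Word = List (Fin k)

  ⊑-refl : (w : Word) → w ⊑ w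
  ⊑-refl w = [] , [] , sym (++-identityʳ w)

  ⊑-++ˡ : (p w : Word) → w ⊑ (p ++ w)
  ⊑-++ˡ p w = p , [] , cong (p ++_) (sym (++-identityʳ w))

  ⊑-trans : {u v w : Word} → u ⊑ v → v ⊑ w → u ⊑ w
  ⊑-trans {u} (p , s , refl) (p′ , s′ , refl) = p′ ++ p , s ++ s′ , (begin
    p′ ++ (p ++ u ++ s) ++ s′  ≡⟨ cong (p′ ++_) (++-assoc p (u ++ s) s′) ⟩
    p′ ++ p ++ (u ++ s) ++ s′  ≡⟨ cong (λ t → p′ ++ p ++ t) (++-assoc u s s′) ⟩
    p′ ++ p ++ u ++ s ++ s′    ≡⟨ sym (++-assoc p′ p _) ⟩
    (p′ ++ p) ++ u ++ s ++ s′  ∎)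
    where open ≡-Reasoning

  ⊑-length : {w u : Word} → w ⊑ u → length w ≤ length u
  ⊑-length {w} (p , s , refl) = begin
    length w                    ≤⟨ m≤m+n (length w) (length s) ⟩
    length w + length s         ≡⟨ sym (length-++ w) ⟩
    length (w ++ s)             ≤⟨ m≤n+m _ (length p) ⟩
    length p + length (w ++ s)  ≡⟨ sym (length-++ p) ⟩
    length (p ++ w ++ s)        ∎
    where open ≤-Reasoning

  ∈-resp-⊑ : {c : Fin k} {u w : Word} → c ∈ u → u ⊑ w → c ∈ w
  ∈-resp-⊑ c∈u (p , s , refl) = ∈-++⁺ʳ p (∈-++⁺ˡ c∈u)

  module _ {B : Set} (f : B → Word) where

    ∈⇒⊑-concatMap : {b : B} {u : List B} → b ∈ u → f b ⊑ concatMap f u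
    ∈⇒⊑-concatMap {u = b ∷ u} (here refl) = [] , concatMap f u , refl
    ∈⇒⊑-concatMap {u = c ∷ u} (there b∈u) = ⊑-trans (∈⇒⊑-concatMap b∈u) (⊑-++ˡ (f c) (concatMap f u))

    module _ {M : ℕ} (bounded : ∀ b → length (f b) ≤ M) where

      concatMap-prefix-block : ∀ u {w s} → concatMap f u ≡ w ++ s → M < length w →
                               ∃[ b ] b ∈ u × f b ⊑ w
      concatMap-prefix-block [] {w} {s} eq M<w with ++-conicalˡ w s (sym eq)
      ... | refl = ⊥-elim (n≮0 M<w)
      concatMap-prefix-block (b ∷ u) {w} {s} eq M<w
        with ++-equidivisible (f b) _ w s eq (≤-trans (bounded b) (<⇒≤ M<w))
      ... | r , refl , _ = b , here refl , [] , r , refl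

      -- Past the block that w starts inside of (at most M letters), more than M letters of w remain,
      -- so the next block lies entirely inside w.
      concatMap-long-factor : ∀ u {p w s} → concatMap f u ≡ p ++ w ++ s → M + M < length w →
                              ∃[ b ] b ∈ u × f b ⊑ w
      concatMap-long-factor [] {p} {w} {s} eq long with ++-conicalˡ w s (++-conicalʳ p _ (sym eq))
      ... | refl = ⊥-elim (n≮0 long)
      concatMap-long-factor (b ∷ u) {p} {w} {s} eq long with ≤-total (length (f b)) (length p)
      ... | inj₁ fb≤p with ++-equidivisible (f b) _ p (w ++ s) eq fb≤p
      ...   | q , refl , eq′ with concatMap-long-factor u {q} eq′ long
      ...     | c , c∈u , fc⊑w = c , there c∈u , fc⊑w
      concatMap-long-factor (b ∷ u) {p} {w} {s} eq long | inj₂ p≤fb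
        with ++-equidivisible p (w ++ s) (f b) (concatMap f u) (sym eq) p≤fb
      ... | r , fb≡pr , ws≡r++ = next-block
        where
        r≤M : length r ≤ M
        r≤M = begin
          length r             ≤⟨ m≤n+m (length r) (length p) ⟩
          length p + length r  ≡⟨ sym (length-++ p) ⟩
          length (p ++ r)      ≡⟨ cong length (sym fb≡pr) ⟩
          length (f b)         ≤⟨ bounded b ⟩
          M                    ∎
          where open ≤-Reasoning
        next-block : ∃[ c ] c ∈ b ∷ u × f c ⊑ w
        next-block with ++-equidivisible r (concatMap f u) w s (sym ws≡r++)
                     (≤-trans r≤M (≤-trans (m≤m+n M M) (<⇒≤ long)))
        ... | w′ , refl , eq′ with concatMap-prefix-block u eq′ M<w′
          where
          M<w′ : M < length w′
          M<w′ = +-cancelˡ-< M M (length w′) (begin-strict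
            M + M                 <⟨ long ⟩
            length (r ++ w′)      ≡⟨ length-++ r ⟩
            length r + length w′  ≤⟨ +-monoˡ-≤ (length w′) r≤M ⟩
            M + length w′         ∎)
            where open ≤-Reasoning
        ... | c , c∈u , fc⊑w′ = c , there c∈u , ⊑-trans fc⊑w′ (⊑-++ˡ r w′)

module _ {k : ℕ} where

  T^ : ℕ → Seq k → Seq k
  T^ i z t = z (i + t)

  prefix : Seq k → ℕ → List (Fin k)
  prefix z zero    = []
  prefix z (suc m) = z 0 ∷ prefix (T z) m

  map-applyUpTo≡prefix : ∀ (g : ℕ → Fin k) h m → map g (applyUpTo h m) ≡ prefix (g ∘ h) m
  map-applyUpTo≡prefix g h zero    = refl
  map-applyUpTo≡prefix g h (suc m) = cong (g (h 0) ∷_) (map-applyUpTo≡prefix g (h ∘ suc) m)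

  window≡prefix : ∀ z i m → window z i m ≡ prefix (T^ i z) m
  window≡prefix z i = map-applyUpTo≡prefix (T^ i z) id

  length-prefix : ∀ z m → length (prefix z m) ≡ m
  length-prefix z zero    = refl
  length-prefix z (suc m) = cong suc (length-prefix (T z) m)

  prefix-+ : ∀ z a b → prefix z (a + b) ≡ prefix z a ++ prefix (T^ a z) b
  prefix-+ z zero    b = refl
  prefix-+ z (suc a) b = cong (z 0 ∷_) (prefix-+ (T z) a b)

  prefix-cong : ∀ {z z′} m → (∀ t → t < m → z t ≡ z′ t) → prefix z m ≡ prefix z′ m
  prefix-cong zero    agree = refl
  prefix-cong (suc m) agree =
    cong₂ _∷_ (agree 0 (s≤s z≤n)) (prefix-cong m (λ t t<m → agree (suc t) (s≤s t<m)))

  prefix-injective : ∀ {z z′} m → prefix z m ≡ prefix z′ m → ∀ t → t < m → z t ≡ z′ t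
  prefix-injective (suc m) eq zero    _         = proj₁ (∷-injective eq)
  prefix-injective (suc m) eq (suc t) (s≤s t<m) = prefix-injective m (proj₂ (∷-injective eq)) t t<m

  prefix-from-nthOr : ∀ d z (u : List (Fin k)) → (∀ t → t < length u → z t ≡ nthOr d u t) →
                      prefix z (length u) ≡ u
  prefix-from-nthOr d z []      agree = refl
  prefix-from-nthOr d z (x ∷ u) agree =
    cong₂ _∷_ (agree 0 (s≤s z≤n)) (prefix-from-nthOr d (T z) u (λ t t< → agree (suc t) (s≤s t<)))

  prefix-of-++ : ∀ z L (w s : List (Fin k)) → prefix z L ≡ w ++ s → prefix z (length w) ≡ w
  prefix-of-++ z L       []      s eq = refl
  prefix-of-++ z (suc L) (x ∷ w) s eq =
    cong₂ _∷_ (proj₁ (∷-injective eq)) (prefix-of-++ (T z) L w s (proj₂ (∷-injective eq)))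

  prefix-of-factor : ∀ z L (p w s : List (Fin k)) → prefix z L ≡ p ++ w ++ s →
                     prefix (T^ (length p) z) (length w) ≡ w
  prefix-of-factor z L       []      w s eq = prefix-of-++ z L w s eq
  prefix-of-factor z (suc L) (x ∷ p) w s eq = prefix-of-factor (T z) L p w s (proj₂ (∷-injective eq))

  window-⊑-prefix : ∀ z i m L → i + m ≤ L → window z i m ⊑ prefix z L
  window-⊑-prefix z i m L i+m≤L with m≤n⇒∃[o]m+o≡n i+m≤L
  ... | e , refl = subst (_⊑ prefix z (i + m + e)) (sym (window≡prefix z i m))
    (prefix z i , prefix (T^ m (T^ i z)) e , (begin
      prefix z (i + m + e)                                         ≡⟨ cong (prefix z) (+-assoc i m e) ⟩
      prefix z (i + (m + e))                                       ≡⟨ prefix-+ z i (m + e) ⟩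
      prefix z i ++ prefix (T^ i z) (m + e)                        ≡⟨ cong (prefix z i ++_) (prefix-+ (T^ i z) m e) ⟩
      prefix z i ++ prefix (T^ i z) m ++ prefix (T^ m (T^ i z)) e  ∎))
    where open ≡-Reasoning

  T^-invariant : {Y : SeqSet k} → ShiftInvariant Y → ∀ {z} → Y z → ∀ i → Y (T^ i z)
  T^-invariant inv Yz zero    = Yz
  T^-invariant inv Yz (suc i) = T^-invariant inv (inv _ Yz) i

  Occurs : Seq k → List (Fin k) → Set
  Occurs z v = ∃[ L ] v ⊑ prefix z L

  Occurs-⊑ : ∀ {z u v} → u ⊑ v → Occurs z v → Occurs z u
  Occurs-⊑ u⊑v (L , v⊑) = L , ⊑-trans u⊑v v⊑

  prefixes-occur⇒∈ : {Y : SeqSet k} → Subsystem Y → ∀ {y} → Y y → ∀ x →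
                     (∀ m → Occurs y (prefix x m)) → Y x
  prefixes-occur⇒∈ {Y} (closed , inv) {y} Yy x occurs = closed x approximant
    where
    approximant : ∀ m → ∃[ y′ ] Y y′ × (∀ j → j < m → y′ j ≡ x j)
    approximant m with occurs m
    ... | L , p , s , eq = T^ (length p) y , T^-invariant inv Yy (length p) ,
      prefix-injective m (subst (λ n → prefix (T^ (length p) y) n ≡ prefix x m) (length-prefix x m)
                                (prefix-of-factor y L p (prefix x m) s eq))

  Windowwise : (List (Fin k) → Set) → SeqSet k
  Windowwise P z = ∀ i m → P (window z i m)

  Windowwise-subsystem : ∀ P → Subsystem (Windowwise P)
  Windowwise-subsystem P = closed , λ z Pz i → Pz (suc i)
    where
    closed : Closed (Windowwise P)
    closed x approx i m with approx (i + m)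
    ... | y , Py , agree = subst P (begin
      window y i m         ≡⟨ window≡prefix y i m ⟩
      prefix (T^ i y) m    ≡⟨ prefix-cong m (λ t t<m → agree (i + t) (+-monoʳ-< i t<m)) ⟩
      prefix (T^ i x) m    ≡⟨ sym (window≡prefix x i m) ⟩
      window x i m         ∎) (Py i m)
      where open ≡-Reasoning

  Subsystem-× : {Y Z : SeqSet k} → Subsystem Y → Subsystem Z → Subsystem (λ z → Y z × Z z)
  Subsystem-× (closedY , invY) (closedZ , invZ) =
    (λ x approx → closedY x (map₂ (map₁ proj₁) ∘ approx) , closedZ x (map₂ (map₁ proj₂) ∘ approx)) ,
    (λ z (Yz , Zz) → invY z Yz , invZ z Zz)

  module Limit (d : Fin k) (u : ℕ → List (Fin k))
               (chain : ∀ {n N} → n ≤ N → ∃[ q ] u N ≡ u n ++ q)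
               (unbounded : ∀ m → ∃[ n ] m ≤ length (u n)) where

    -- unbounded (suc t) picks a chain element with more than t letters, so the default d is never returned.
    lim : Seq k
    lim t = nthOr d (u (proj₁ (unbounded (suc t)))) t

    lim-nthOr : ∀ n t → t < length (u n) → lim t ≡ nthOr d (u n) t
    lim-nthOr n t t< with ≤-total n (proj₁ (unbounded (suc t)))
    ... | inj₁ n≤ with chain n≤
    ...   | q , eq = trans (cong (λ v → nthOr d v t) eq) (nthOr-++ d (u n) q t<)
    lim-nthOr n t t< | inj₂ ≤n with chain ≤n
    ...   | q , eq = sym (trans (cong (λ v → nthOr d v t) eq)
                                (nthOr-++ d (u (proj₁ (unbounded (suc t)))) q (proj₂ (unbounded (suc t)))))

    lim-windows : ∀ i m → ∃[ n ] window lim i m ⊑ u n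
    lim-windows i m with unbounded (i + m)
    ... | n , i+m≤ = n , subst (window lim i m ⊑_) (prefix-from-nthOr d lim (u n) (lim-nthOr n))
                                (window-⊑-prefix lim i m (length (u n)) i+m≤)

module _ (lem : ExcludedMiddle 0ℓ) where

  pigeonhole-downwardClosed : ∀ {m} (Q : Fin m → ℕ → Set) → (∀ a {n N} → n ≤ N → Q a N → Q a n) →
                              (∀ N → ∃[ a ] Q a N) → ∃[ a ] ∀ n → Q a n
  pigeonhole-downwardClosed {zero} Q down cover with cover 0
  ... | () , _
  pigeonhole-downwardClosed {suc m} Q down cover with lem {∃[ n ] ¬ Q zero n}
  ... | no ¬∃ = zero , λ n → em⇒dne lem (λ ¬q → ¬∃ (n , ¬q))
  ... | yes (n₀ , ¬q₀) with pigeonhole-downwardClosed (Q ∘ suc) (λ a → down (suc a)) cover′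
    where
    cover′ : ∀ N → ∃[ a ] Q (suc a) N
    cover′ N with cover (N + n₀)
    ... | zero  , q = ⊥-elim (¬q₀ (down zero (m≤n+m n₀ N) q))
    ... | suc a , q = a , down (suc a) (m≤m+n N n₀) q
  ... | a , always = suc a , always

Fin-bounded : ∀ {m} (f : Fin m → ℕ) → ∃[ M ] ∀ a → f a ≤ M
Fin-bounded {zero}  f = 0 , λ ()
Fin-bounded {suc m} f with Fin-bounded (f ∘ suc)
... | M , f≤M = f zero + M , λ { zero → m≤m+n (f zero) M ; (suc a) → ≤-trans (f≤M a) (m≤n+m M (f zero)) }

module _ {k : ℕ} (φ : Substitution k) where

  private
    _≽ᵩ_ _≻ᵩ_ _≺ᵩ_ : Fin k → Fin k → Set
    _≽ᵩ_ = _≽_ φ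
    _≻ᵩ_ = _≻_ φ
    c ≺ᵩ a = a ≻ᵩ c

  iterW-++ : ∀ n (u v : List (Fin k)) → iterW φ n (u ++ v) ≡ iterW φ n u ++ iterW φ n v
  iterW-++ zero    u v = refl
  iterW-++ (suc n) u v = trans (cong (φ* φ) (iterW-++ n u v)) (concatMap-++ φ (iterW φ n u) (iterW φ n v))

  iterW-concatMap : ∀ n (u : List (Fin k)) → iterW φ n u ≡ concatMap (φ^ φ n) u
  iterW-concatMap zero    []      = refl
  iterW-concatMap (suc n) []      = cong (φ* φ) (iterW-concatMap n [])
  iterW-concatMap n       (c ∷ u) = trans (iterW-++ n (c ∷ []) u) (cong (φ^ φ n c ++_) (iterW-concatMap n u))

  iterW-+ : ∀ n m w → iterW φ (n + m) w ≡ iterW φ n (iterW φ m w)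
  iterW-+ zero    m w = refl
  iterW-+ (suc n) m w = cong (φ* φ) (iterW-+ n m w)

  iterW-suc : ∀ n w → iterW φ (suc n) w ≡ iterW φ n (φ* φ w)
  iterW-suc zero    w = refl
  iterW-suc (suc n) w = cong (φ* φ) (iterW-suc n w)

  φ^-+ : ∀ n m a → φ^ φ (n + m) a ≡ concatMap (φ^ φ n) (φ^ φ m a)
  φ^-+ n m a = trans (iterW-+ n m (a ∷ [])) (iterW-concatMap n (φ^ φ m a))

  φ^-suc : ∀ n a → φ^ φ (suc n) a ≡ concatMap (φ^ φ n) (φ a)
  φ^-suc n a = begin
    φ^ φ (suc n) a                ≡⟨ iterW-suc n (a ∷ []) ⟩
    iterW φ n (φ a ++ [])         ≡⟨ cong (iterW φ n) (++-identityʳ (φ a)) ⟩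
    iterW φ n (φ a)               ≡⟨ iterW-concatMap n (φ a) ⟩
    concatMap (φ^ φ n) (φ a)      ∎
    where open ≡-Reasoning

  ∈φ⇒φ^⊑φ^-suc : ∀ n {a c} → c ∈ φ a → φ^ φ n c ⊑ φ^ φ (suc n) a
  ∈φ⇒φ^⊑φ^-suc n {a} c∈ = subst (φ^ φ n _ ⊑_) (sym (φ^-suc n a)) (∈⇒⊑-concatMap (φ^ φ n) c∈)

  ∈φ⇒≽ : ∀ {a c} → c ∈ φ a → a ≽ᵩ c
  ∈φ⇒≽ {a} c∈ = 1 , subst (_ ∈_) (sym (++-identityʳ (φ a))) c∈

  ≽-refl : ∀ {a} → a ≽ᵩ a
  ≽-refl = 0 , here refl

  ≽-trans : ∀ {a b c} → a ≽ᵩ b → b ≽ᵩ c → a ≽ᵩ c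
  ≽-trans {a} (i , b∈) (j , c∈) =
    j + i , subst (_ ∈_) (sym (φ^-+ j i a)) (∈-resp-⊑ c∈ (∈⇒⊑-concatMap (φ^ φ j) b∈))

  ≺-isStrictPartialOrder : IsStrictPartialOrder _≡_ _≺ᵩ_
  ≺-isStrictPartialOrder = record
    { isEquivalence = isEquivalence
    ; irrefl        = λ { refl (_ , not∼) → not∼ (≽-refl , ≽-refl) }
    ; trans         = λ { (b≽a , a≁b) (c≽b , b≁c) →
        ≽-trans c≽b b≽a , λ (a≽c , c≽a) → b≁c (≽-trans b≽a a≽c , c≽b) }
    ; <-resp-≈      = (λ { refl c≺a → c≺a }) , (λ { refl c≺a → c≺a })
    }

  module _ (lem : ExcludedMiddle 0ℓ) where

    minimal-below : ∀ a → ∃[ b ] MinimalLetter φ b × a ≽ᵩ b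
    minimal-below a = descend a (spo-wellFounded ≺-isStrictPartialOrder a)
      where
      descend : ∀ a → Acc _≺ᵩ_ a → ∃[ b ] MinimalLetter φ b × a ≽ᵩ b
      descend a (acc below) with lem {∃[ c ] a ≻ᵩ c}
      ... | no ¬∃ = a , ¬∃ , ≽-refl
      ... | yes (c , a≻c) with descend c (below a≻c)
      ...   | b , min , c≽b = b , min , ≽-trans (proj₁ a≻c) c≽b

    minimal-≽-sym : ∀ {b c} → MinimalLetter φ b → b ≽ᵩ c → c ≽ᵩ b
    minimal-≽-sym {b} {c} min b≽c with lem {c ≽ᵩ b}
    ... | yes c≽b = c≽b
    ... | no c⋡b  = ⊥-elim (min (c , b≽c , λ (c≽b , _) → c⋡b c≽b))

  φ^-prefix-chain : ∀ {c r} → φ c ≡ c ∷ r → ∀ {n N} → n ≤ N → ∃[ q ] φ^ φ N c ≡ φ^ φ n c ++ q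
  φ^-prefix-chain {c} {r} φc≡ {n} n≤N = chain (≤⇒≤′ n≤N)
    where
    chain : ∀ {N} → n ≤′ N → ∃[ q ] φ^ φ N c ≡ φ^ φ n c ++ q
    chain ≤′-refl = [] , sym (++-identityʳ _)
    chain {suc N} (≤′-step n≤N) with chain n≤N
    ... | q , eq = q ++ concatMap (φ^ φ N) r , (begin
      φ^ φ (suc N) c                                 ≡⟨ φ^-suc N c ⟩
      concatMap (φ^ φ N) (φ c)                       ≡⟨ cong (concatMap (φ^ φ N)) φc≡ ⟩
      φ^ φ N c ++ concatMap (φ^ φ N) r               ≡⟨ cong (_++ concatMap (φ^ φ N) r) eq ⟩
      (φ^ φ n c ++ q) ++ concatMap (φ^ φ N) r        ≡⟨ ++-assoc (φ^ φ n c) q _ ⟩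
      φ^ φ n c ++ q ++ concatMap (φ^ φ N) r          ∎)
      where open ≡-Reasoning

  X_-subsystem : ∀ b → Subsystem (X_ φ b)
  X_-subsystem b = Subsystem-× (Windowwise-subsystem (λ w → ∃[ n ] ∃[ a ] w ⊑ φ^ φ n a))
                               (Windowwise-subsystem (λ w → ∃[ n ] w ⊑ φ^ φ n b))

  module _ (growing : Growing φ) where

    φ-nonempty : ∀ a → ∃[ c ] ∃[ r ] φ a ≡ c ∷ r
    φ-nonempty a with φ a in φa≡
    ... | c ∷ r = c , r , refl
    ... | [] with growing a 2
    ...   | zero , s≤s ()
    ...   | suc n , 2≤ with subst (λ w → 2 ≤ length w) (trans (φ^-suc n a) (cong (concatMap (φ^ φ n)) φa≡)) 2≤
    ...     | ()

    length-≤-φ* : ∀ w → length w ≤ length (φ* φ w)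
    length-≤-φ* []      = z≤n
    length-≤-φ* (x ∷ w) with φ-nonempty x
    ... | c , r , φx≡ = begin
      1 + length w                      ≤⟨ +-mono-≤ (subst (λ v → 1 ≤ length v) (sym φx≡) (s≤s z≤n)) (length-≤-φ* w) ⟩
      length (φ x) + length (φ* φ w)    ≡⟨ sym (length-++ (φ x)) ⟩
      length (φ* φ (x ∷ w))             ∎
      where open ≤-Reasoning

    length-φ^-mono : ∀ a {n N} → n ≤ N → length (φ^ φ n a) ≤ length (φ^ φ N a)
    length-φ^-mono a {n} n≤N = mono (≤⇒≤′ n≤N)
      where
      mono : ∀ {N} → n ≤′ N → length (φ^ φ n a) ≤ length (φ^ φ N a)
      mono ≤′-refl                 = ≤-refl
      mono {suc N} (≤′-step n≤′N) = ≤-trans (mono n≤′N) (length-≤-φ* (φ^ φ N a))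

    long-factor-contains-block : ∀ n → ∃[ L ] ∀ a N (w : List (Fin k)) → w ⊑ φ^ φ N a → L ≤ length w →
                                 ∃[ c ] a ≽ᵩ c × φ^ φ (suc n) c ⊑ w
    long-factor-contains-block n with Fin-bounded (λ c → length (φ^ φ (suc n) c))
    ... | M , bound = suc (M + M) , block
      where
      block : ∀ a N (w : List (Fin k)) → w ⊑ φ^ φ N a → suc (M + M) ≤ length w →
              ∃[ c ] a ≽ᵩ c × φ^ φ (suc n) c ⊑ w
      block a N w w⊑ long with suc n ≤? N
      ... | no N≱ = ⊥-elim (<-irrefl refl (begin-strict
        M + M                   <⟨ long ⟩
        length w                ≤⟨ ⊑-length w⊑ ⟩
        length (φ^ φ N a)       ≤⟨ length-φ^-mono a (<⇒≤ (≰⇒> N≱)) ⟩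
        length (φ^ φ (suc n) a) ≤⟨ bound a ⟩
        M                       ≤⟨ m≤m+n M M ⟩
        M + M                   ∎))
        where open ≤-Reasoning
      ... | yes n<N with m≤n⇒∃[o]m+o≡n n<N | w⊑
      ...   | o , refl | p , s , eq
        with concatMap-long-factor (φ^ φ (suc n)) bound (φ^ φ o a) {p} (trans (sym (φ^-+ (suc n) o a)) eq) long
      ...     | c , c∈ , block⊑ = c , (o , c∈) , block⊑

module IdempotentSubstitution (lem : ExcludedMiddle 0ℓ) {k : ℕ} (φ : Substitution k)
                              (growing : Growing φ) (idem : Idempotent φ) where

  private
    _≽ᵩ_ : Fin k → Fin k → Set
    _≽ᵩ_ = _≽_ φ

  letters-φ^ : ∀ n {a c} → c ∈ φ^ φ (suc n) a → c ∈ φ a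
  letters-φ^ n {a} {c} = Equivalence.from (proj₁ idem a n c)

  first-letter-prolongable : ∀ a c → head (φ a) ≡ just c → Prolongable φ c
  first-letter-prolongable = proj₁ (proj₂ (proj₂ idem))

  ∈φ-≽⇒∈φ : ∀ {a b c} → c ∈ φ a → c ≽ᵩ b → b ∈ φ a
  ∈φ-≽⇒∈φ c∈ (j , b∈) = letters-φ^ j (∈-resp-⊑ b∈ (∈φ⇒φ^⊑φ^-suc φ j c∈))

  minimal-∈φ-self : ∀ {b} → MinimalLetter φ b → b ∈ φ b
  minimal-∈φ-self {b} min with φ-nonempty φ growing b
  ... | c , _ , φb≡ = ∈φ-≽⇒∈φ c∈ (minimal-≽-sym φ lem min (∈φ⇒≽ φ c∈))
    where
    c∈ : c ∈ φ b
    c∈ = subst (c ∈_) (sym φb≡) (here refl)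

  ≽-∈φ-self⇒∈φ : ∀ {a b} → a ≽ᵩ b → b ∈ φ b → b ∈ φ a
  ≽-∈φ-self⇒∈φ (zero  , here refl) b∈ = b∈
  ≽-∈φ-self⇒∈φ (suc n , b∈)        _  = letters-φ^ n b∈

  minimal-∈φ : ∀ {b c} → MinimalLetter φ b → b ≽ᵩ c → b ∈ φ c
  minimal-∈φ min b≽c = ≽-∈φ-self⇒∈φ (minimal-≽-sym φ lem min b≽c) (minimal-∈φ-self min)

  ∃minimal-∈φ : ∀ a → ∃[ b ] MinimalLetter φ b × b ∈ φ a
  ∃minimal-∈φ a with minimal-below φ lem a
  ... | b , min , a≽b = b , min , ≽-∈φ-self⇒∈φ a≽b (minimal-∈φ-self min)

  minimal-φ^-⊑ : ∀ {b} → MinimalLetter φ b → ∀ {n N} → n ≤ N → φ^ φ n b ⊑ φ^ φ N b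
  minimal-φ^-⊑ {b} min {n} n≤N = chain (≤⇒≤′ n≤N)
    where
    chain : ∀ {N} → n ≤′ N → φ^ φ n b ⊑ φ^ φ N b
    chain ≤′-refl                 = ⊑-refl (φ^ φ n b)
    chain {suc N} (≤′-step n≤′N) = ⊑-trans (chain n≤′N) (∈φ⇒φ^⊑φ^-suc φ N (minimal-∈φ-self min))

  X_-nonempty : ∀ b → ∃[ z ] X_ φ b z
  X_-nonempty b with φ-nonempty φ growing b
  ... | c , _ , φb≡ with head-just (first-letter-prolongable b c (cong head φb≡))
  ... | _ , φc≡ = lim , (λ i m → map₂ (b ,_) (windows i m)) , windows
    where
    open Limit c (λ n → φ^ φ n c) (φ^-prefix-chain φ φc≡) (growing c)
    windows : ∀ i m → ∃[ n ] window lim i m ⊑ φ^ φ n b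
    windows i m with lim-windows i m
    ... | n , w⊑ = suc n , ⊑-trans w⊑ (∈φ⇒φ^⊑φ^-suc φ n (subst (c ∈_) (sym φb≡) (here refl)))

  blocks-occur : ∀ n → ∃[ L ] ∀ {y a N} → window y 0 L ⊑ φ^ φ N a →
                 ∃[ c ] a ≽ᵩ c × Occurs y (φ^ φ (suc n) c)
  blocks-occur n with long-factor-contains-block φ growing n
  ... | L , block = L , λ {y} {a} {N} w⊑ →
    map₂ (map₂ (L ,_)) (block a N (prefix y L) (subst (_⊑ φ^ φ N a) (window≡prefix y 0 L) w⊑)
                              (≤-reflexive (sym (length-prefix y L))))

  X_φ-minimal-occurs : ∀ {y} → X_φ φ y → ∀ n → ∃[ b ] MinimalLetter φ b × Occurs y (φ^ φ n b)
  X_φ-minimal-occurs {y} y∈ n with blocks-occur n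
  ... | L , occurs with y∈ 0 L
  ... | N , a , w⊑ with occurs {y} {a} {N} w⊑
  ... | c , _ , occ with ∃minimal-∈φ c
  ... | b , min , b∈ = b , min , Occurs-⊑ (∈φ⇒φ^⊑φ^-suc φ n b∈) occ

  X_-occurs : ∀ {b z} → MinimalLetter φ b → X_ φ b z → ∀ n → Occurs z (φ^ φ n b)
  X_-occurs {b} {z} min (_ , z∈) n with blocks-occur n
  ... | L , occurs with z∈ 0 L
  ... | N , w⊑ with occurs {z} {b} {N} w⊑
  ... | c , b≽c , occ = Occurs-⊑ (∈φ⇒φ^⊑φ^-suc φ n (minimal-∈φ min b≽c)) occ

  X_φ-recurrent : ∀ {y} → X_φ φ y → ∃[ b ] MinimalLetter φ b × ∀ n → Occurs y (φ^ φ n b)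
  X_φ-recurrent {y} y∈ =
    map₂ (λ always → proj₁ (always 0) , proj₂ ∘ always)
         (pigeonhole-downwardClosed lem Q down (X_φ-minimal-occurs y∈))
    where
    Q : Fin k → ℕ → Set
    Q b n = MinimalLetter φ b × Occurs y (φ^ φ n b)
    down : ∀ b {n N} → n ≤ N → Q b N → Q b n
    down b n≤N (min , occ) = min , Occurs-⊑ (minimal-φ^-⊑ min n≤N) occ

  recurrent⇒X_⊆ : ∀ {Y : SeqSet k} {y b} → Subsystem Y → Y y → (∀ n → Occurs y (φ^ φ n b)) → X_ φ b ⊆ˢ Y
  recurrent⇒X_⊆ {y = y} {b} subsystem Yy occurs x (_ , x∈) = prefixes-occur⇒∈ subsystem Yy x prefix-occurs
    where
    prefix-occurs : ∀ m → Occurs y (prefix x m)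
    prefix-occurs m with x∈ 0 m
    ... | n , w⊑ = Occurs-⊑ (subst (_⊑ φ^ φ n b) (window≡prefix x 0 m) w⊑) (occurs n)

proposition2p2 : ExcludedMiddle 0ℓ → {k : ℕ} (φ : Substitution k) →
    Growing φ → Idempotent φ → (Y : SeqSet k) → SubsystemOf Y (X_φ φ) →
    Minimal Y ⇔ (∃[ b ] MinimalLetter φ b × (Y ≐ X_ φ b))
proposition2p2 lem {k} φ growing idem Y (subsystem , Y⊆X) = mk⇔ to from
  where
  open IdempotentSubstitution lem φ growing idem

  to : Minimal Y → ∃[ b ] MinimalLetter φ b × (Y ≐ X_ φ b)
  to ((y , Yy) , minimal) = conclude (X_φ-recurrent (Y⊆X y Yy))
    where
    conclude : (∃[ b ] MinimalLetter φ b × ∀ n → Occurs y (φ^ φ n b)) →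
               ∃[ b ] MinimalLetter φ b × (Y ≐ X_ φ b)
    conclude (b , min , recurrent) =
      [ (λ (X_⊆Y , Y⊆X_) → b , min , Y⊆X_ , X_⊆Y) , (λ empty → ⊥-elim (uncurry empty (X_-nonempty b))) ]′
        (minimal (X_ φ b) (X_-subsystem φ b , recurrent⇒X_⊆ subsystem Yy recurrent))

  from : ∃[ b ] MinimalLetter φ b × (Y ≐ X_ φ b) → Minimal Y
  from (b , min , Y⊆X_ , X_⊆Y) = map₂ (λ {z} → X_⊆Y z) (X_-nonempty b) , only-trivial
    where
    only-trivial : ∀ (Z : SeqSet k) → SubsystemOf Z Y → (Z ≐ Y) ⊎ Empty Z
    only-trivial Z (subsystemZ , Z⊆Y) with lem {∃[ z ] Z z}
    ... | no ¬∃        = inj₂ (λ z Zz → ¬∃ (z , Zz))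
    ... | yes (z , Zz) = inj₁ (Z⊆Y , λ x Yx →
      recurrent⇒X_⊆ subsystemZ Zz (X_-occurs min (Y⊆X_ z (Z⊆Y z Zz))) x (Y⊆X_ x Yx))
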